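{- Let $\mathcal{R}$ be a $\mathcal{SHIQ}$ RBox and let $M=\langle\Delta,\mathcal{I}_0,\mathcal{C},\mathcal{E}\rangle$ be a consistent $\mathcal{R}$-saturated model graph. Let $\mathcal{I}$ be the $\mathcal{R}$-model corresponding to $M$. Then $\mathcal{I}$ is a model of $\mathcal{R}$, and for every $x\in\Delta$ and every concept $C\in\mathcal{C}(x)$ we have $x\in C^{\mathcal{I}}$.
   Context: Setting: $\mathcal{SHIQ}$. Roles are role names $r$ or inverses $r^-$ (with $(r^-)^-=r$). An RBox $\mathcal{R}$ is a finite set of axioms $R\sqsubseteq S$ or $R\circ R\sqsubseteq R$; $\mathit{ext}(\mathcal{R})$ is its least extension containing $R\sqsubseteq R$ for all roles, closed under $R\sqsubseteq S\mapsto R^-\sqsubseteq S^-$, $R\circ R\sqsubseteq R\mapsto R^-\circ R^-\sqsubseteq R^-$, and transitivity of $\sqsubseteq$. $R\sqsubseteq_{\mathcal{R}}S$ means $(R\sqsubseteq S)\in\mathit{ext}(\mathcal{R})$; $\mathrm{Trans}(R)$ means $(R\circ R\sqsubseteq R)\in\mathit{ext}(\mathcal{R})$; a role is simple if it is not transitive and has no transitive subrole. Concepts are $\top,\bot,A,\neg C, C\sqcap D, C\sqcup D,\exists R.C,\forall R.C,\geq n\,S.C,\leq n\,S.C$ ($S$ simple), with standard semantics; throughout, concepts are in negation normal form ($\neg$ only directly before concept names), and $\overline{C}$ denotes the negation normal form of $\neg C$. An interpretation is a model of $\mathcal{R}$ if $R^{\mathcal{I}}\subseteq S^{\mathcal{I}}$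 for each $R\sqsubseteq S\in\mathcal{R}$ and $R^{\mathcal{I}}\circ R^{\mathcal{I}}\subseteq R^{\mathcal{I}}$ for each $R\circ R\sqsubseteq R\in\mathcal{R}$. A model graph is a tuple $\langle\Delta,\mathcal{I}_0,\mathcal{C},\mathcal{E}\rangle$ where $\Delta$ is a nonempty finite set, $\mathcal{I}_0$ maps each individual name to an element of $\Delta$, $\mathcal{C}$ maps each element of $\Delta$ to a set of concepts, and $\mathcal{E}$ maps each role to a binary relation on $\Delta$. It is consistent and $\mathcal{R}$-saturated if for every $x\in\Delta$: $\mathcal{C}(x)$ contains neither $\bot$ nor any pair $C,\overline{C}$; if $\langle x,y\rangle\in\mathcal{E}(R)$ then $\langle y,x\rangle\in\mathcal{E}(R^-)$; if $\langle x,y\rangle\in\mathcal{E}(R)$ and $R\sqsubseteq_{\mathcal{R}}S$ then $\langle x,y\rangle\in\mathcal{E}(S)$; if $C\sqcap D\in\mathcal{C}(x)$ then $C,D\in\mathcal{C}(x)$; if $C\sqcup D\in\mathcal{C}(x)$ then $C\in\mathcal{C}(x)$ or $D\in\mathcal{C}(x)$; if $\forall S.C\in\mathcal{C}(x)$ and $R\sqsubseteq_{\mathcal{R}}S$ then $\forall R.C\in\mathcal{C}(x)$; if $\langle x,y\rangle\in\mathcal{E}(R)$ and $\forall R.C\in\mathcal{C}(x)$ then $C\in\mathcal{C}(y)$; if $\langle x,y\rangle\in\mathcal{E}(R)$, $\mathrm{Trans}(R)$ and $\forall R.C\in\mathcal{C}(x)$ then $\forall R.C\in\mathcal{C}(y)$;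 if $\exists R.C\in\mathcal{C}(x)$ then there is $y$ with $\langle x,y\rangle\in\mathcal{E}(R)$ and $C\in\mathcal{C}(y)$; if $\geq n\,R.C\in\mathcal{C}(x)$ then $\#\{y\mid\langle x,y\rangle\in\mathcal{E}(R), C\in\mathcal{C}(y)\}\ge n$; if $\leq n\,R.C\in\mathcal{C}(x)$ then $\#\{y\mid\langle x,y\rangle\in\mathcal{E}(R), C\in\mathcal{C}(y)\}\le n$; if $\leq n\,R.C\in\mathcal{C}(x)$ and $\langle x,y\rangle\in\mathcal{E}(R)$ then $C\in\mathcal{C}(y)$ or $\overline{C}\in\mathcal{C}(y)$. The $\mathcal{R}$-model corresponding to $M$ is the interpretation $\mathcal{I}$ with domain $\Delta$, $a^{\mathcal{I}}=\mathcal{I}_0(a)$ for individual names $a$, $A^{\mathcal{I}}=\{x\in\Delta\mid A\in\mathcal{C}(x)\}$ for concept names $A$, and $r^{\mathcal{I}}=\mathcal{E}'(r)$ for role names $r$, where $(\mathcal{E}'(R))_R$ is the family of smallest binary relations on $\Delta$ (indexed by roles) such that $\mathcal{E}(R)\subseteq\mathcal{E}'(R)$, $\mathcal{E}'(R)\subseteq\mathcal{E}'(S)$ whenever $R\sqsubseteq_{\mathcal{R}}S$, and $\mathcal{E}'(R)\circ\mathcal{E}'(R)\subseteq\mathcal{E}'(R)$ whenever $\mathrm{Trans}(R)$. -}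

module Defs where

open import Data.Nat using (ℕ; zero; suc; _≤_)
open import Data.Fin using (Fin)
open import Data.List using (List; length)
open import Data.List.Membership.Propositional using (_∈_)
open import Data.List.Relation.Unary.All using (All)
open import Data.List.Relation.Unary.Unique.Propositional using (Unique)
open import Data.Product using (Σ; _×_; ∃)
open import Data.Sum using (_⊎_)
open import Data.Empty using (⊥)
open import Data.Unit using (⊤)
open import Relation.Nullary using (¬_)
open import Relation.Binary.PropositionalEquality using (_≡_)

RoleName ConceptName IndName : Set
RoleName = ℕ
ConceptName = ℕ
IndName = ℕ

data Role : Set where
  rn  : RoleName → Role
  inv : RoleName → Role

-- (r⁻)⁻ = r holds definitionally.
infix 30 _⁻
_⁻ : Role → Role
rn r ⁻ = inv r
inv r ⁻ = rn r

infix 5 _⊑_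
data Axiom : Set where
  _⊑_     : Role → Role → Axiom
  trans∘  : Role → Axiom          -- R ∘ R ⊑ R

RBox : Set
RBox = List Axiom

infix 4 _⊢_⊑_
data _⊢_⊑_ (ℛ : RBox) : Role → Role → Set where
  ax    : ∀ {R S} → (R ⊑ S) ∈ ℛ → ℛ ⊢ R ⊑ S
  refl  : ∀ {R} → ℛ ⊢ R ⊑ R
  inv   : ∀ {R S} → ℛ ⊢ R ⊑ S → ℛ ⊢ R ⁻ ⊑ S ⁻
  trans : ∀ {R S T} → ℛ ⊢ R ⊑ S → ℛ ⊢ S ⊑ T → ℛ ⊢ R ⊑ T

data Trans (ℛ : RBox) : Role → Set where
  ax  : ∀ {R} → trans∘ R ∈ ℛ → Trans ℛ R
  inv : ∀ {R} → Trans ℛ R → Trans ℛ (R ⁻)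

Simple : RBox → Role → Set
Simple ℛ R = ¬ Trans ℛ R × (∀ S → ℛ ⊢ S ⊑ R → ¬ Trans ℛ S)

infixr 7 _⊓_
infixr 6 _⊔_
data Concept : Set where
  ⊤c ⊥c     : Concept
  atom      : ConceptName → Concept
  natom     : ConceptName → Concept
  _⊓_ _⊔_   : Concept → Concept → Concept
  some all  : Role → Concept → Concept
  atLeast atMost : ℕ → Role → Concept → Concept

neg : Concept → Concept
neg ⊤c = ⊥c
neg ⊥c = ⊤c
neg (atom A) = natom A
neg (natom A) = atom A
neg (C ⊓ D) = neg C ⊔ neg D
neg (C ⊔ D) = neg C ⊓ neg D
neg (some R C) = all R (neg C)
neg (all R C) = some R (neg C)
neg (atLeast zero S C) = ⊥c
neg (atLeast (suc n) S C) = atMost n S C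
neg (atMost n S C) = atLeast (suc n) S C

data WF (ℛ : RBox) : Concept → Set where
  ⊤c    : WF ℛ ⊤c
  ⊥c    : WF ℛ ⊥c
  atom  : ∀ A → WF ℛ (atom A)
  natom : ∀ A → WF ℛ (natom A)
  _⊓_   : ∀ {C D} → WF ℛ C → WF ℛ D → WF ℛ (C ⊓ D)
  _⊔_   : ∀ {C D} → WF ℛ C → WF ℛ D → WF ℛ (C ⊔ D)
  some  : ∀ R {C} → WF ℛ C → WF ℛ (some R C)
  all   : ∀ R {C} → WF ℛ C → WF ℛ (all R C)
  atLeast : ∀ n {S C} → Simple ℛ S → WF ℛ C → WF ℛ (atLeast n S C)
  atMost  : ∀ n {S C} → Simple ℛ S → WF ℛ C → WF ℛ (atMost n S C)

AtLeast : {D : Set} → ℕ → (D → Set) → Set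
AtLeast {D} n P = Σ (List D) λ ys → length ys ≡ n × Unique ys × All P ys

AtMost : {D : Set} → ℕ → (D → Set) → Set
AtMost {D} n P = (ys : List D) → Unique ys → All P ys → length ys ≤ n

record Interpretation : Set₁ where
  field
    Dom  : Set
    ind  : IndName → Dom
    conc : ConceptName → Dom → Set
    role : RoleName → Dom → Dom → Set

module _ (I : Interpretation) where
  open Interpretation I

  roleI : Role → Dom → Dom → Set
  roleI (rn r) x y = role r x y
  roleI (inv r) x y = role r y x

  ⟦_⟧ : Concept → Dom → Set
  ⟦ ⊤c ⟧ x = ⊤
  ⟦ ⊥c ⟧ x = ⊥
  ⟦ atom A ⟧ x = conc A x
  ⟦ natom A ⟧ x = ¬ conc A x
  ⟦ C ⊓ D ⟧ x = ⟦ C ⟧ x × ⟦ D ⟧ x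
  ⟦ C ⊔ D ⟧ x = ⟦ C ⟧ x ⊎ ⟦ D ⟧ x
  ⟦ some R C ⟧ x = ∃ λ y → roleI R x y × ⟦ C ⟧ y
  ⟦ all R C ⟧ x = ∀ y → roleI R x y → ⟦ C ⟧ y
  ⟦ atLeast n S C ⟧ x = AtLeast n (λ y → roleI S x y × ⟦ C ⟧ y)
  ⟦ atMost n S C ⟧ x = AtMost n (λ y → roleI S x y × ⟦ C ⟧ y)

  ModelOfRBox : RBox → Set
  ModelOfRBox ℛ =
    (∀ R S → (R ⊑ S) ∈ ℛ → ∀ x y → roleI R x y → roleI S x y) ×
    (∀ R → trans∘ R ∈ ℛ → ∀ x y z → roleI R x y → roleI R y z → roleI R x z)

record ModelGraph : Set₁ where
  field
    size : ℕ
    I₀   : IndName → Fin (suc size)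
    𝒞    : Fin (suc size) → Concept → Set
    ℰ    : Role → Fin (suc size) → Fin (suc size) → Set

  Δ : Set
  Δ = Fin (suc size)

module _ (ℛ : RBox) (M : ModelGraph) where
  open ModelGraph M

  record ConsistentSaturated : Set where
    field
      no-⊥    : ∀ x → ¬ 𝒞 x ⊥c
      no-clash : ∀ x C → 𝒞 x C → ¬ 𝒞 x (neg C)
      ℰ-inv   : ∀ R x y → ℰ R x y → ℰ (R ⁻) y x
      ℰ-sub   : ∀ R S x y → ℰ R x y → ℛ ⊢ R ⊑ S → ℰ S x y
      ⊓-rule  : ∀ x C D → 𝒞 x (C ⊓ D) → 𝒞 x C × 𝒞 x D
      ⊔-rule  : ∀ x C D → 𝒞 x (C ⊔ D) → 𝒞 x C ⊎ 𝒞 x D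
      ∀-sub   : ∀ x R S C → 𝒞 x (all S C) → ℛ ⊢ R ⊑ S → 𝒞 x (all R C)
      ∀-rule  : ∀ x y R C → ℰ R x y → 𝒞 x (all R C) → 𝒞 y C
      ∀-trans : ∀ x y R C → ℰ R x y → Trans ℛ R → 𝒞 x (all R C) → 𝒞 y (all R C)
      ∃-rule  : ∀ x R C → 𝒞 x (some R C) → ∃ λ y → ℰ R x y × 𝒞 y C
      ≥-rule  : ∀ x n R C → 𝒞 x (atLeast n R C) → AtLeast n (λ y → ℰ R x y × 𝒞 y C)
      ≤-rule  : ∀ x n R C → 𝒞 x (atMost n R C) → AtMost n (λ y → ℰ R x y × 𝒞 y C)
      ≤-choose : ∀ x y n R C → 𝒞 x (atMost n R C) → ℰ R x y → 𝒞 y C ⊎ 𝒞 y (neg C)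

  data ℰ′ : Role → Δ → Δ → Set where
    base : ∀ {R x y} → ℰ R x y → ℰ′ R x y
    sub  : ∀ {R S x y} → ℛ ⊢ R ⊑ S → ℰ′ R x y → ℰ′ S x y
    tr   : ∀ {R x y z} → Trans ℛ R → ℰ′ R x y → ℰ′ R y z → ℰ′ R x z

  correspondingModel : Interpretation
  correspondingModel = record
    { Dom = Δ
    ; ind = I₀
    ; conc = λ A x → 𝒞 x (atom A)
    ; role = λ r → ℰ′ (rn r)
    }

-- Let I be the ℛ-model corresponding to a consistent, ℛ-saturated model
-- graph M, whose roles are interpreted by the closure ℰ′ of ℰ under role
-- inclusions and transitivity.
--  * I is a model of ℛ: ℰ′ is closed under inverses, so the semantics of
--    an inverse role coincides with ℰ′ on that role, and ℰ′ is closed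
--    under the axioms of ℛ by construction.
--  * Every label is true ("truth lemma"), by induction on C, proved jointly
--    for C and its negation normal form C̄ (≤ needs C̄ to discard successors
--    violating C).  Two facts about ℰ′ carry the argument:
--      - a value restriction ∀T.C at x reaches every ℰ′-successor of x along
--        a subrole of T, because saturation propagates ∀T.C along
--        transitive roles;
--      - ℰ′-edges of a simple role are already ℰ-edges, so number
--        restrictions (over simple roles) count exactly the ℰ-successors.
module Submission where

open import Defs
open import Data.Product using (_×_; _,_; proj₁; proj₂)
open import Data.Sum using (inj₁; inj₂)
open import Data.Empty using (⊥-elim)
open import Data.Unit using (tt)
open import Data.Nat using (suc; zero; _≤_)
open import Data.Nat.Properties using (1+n≰n)
open import Data.List.Relation.Unary.All as All using ()
open import Relation.Nullary using (¬_)
open import Relation.Binary.PropositionalEquality using (subst)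

-- In any interpretation, a concept and its negation normal form are
-- never both satisfied (the only non-structural cases are the number
-- restrictions, where ≥ n+1 and ≤ n give a list too long to be at most n).
neg-excludes : (I : Interpretation) → ∀ C x → ⟦ I ⟧ (neg C) x → ¬ ⟦ I ⟧ C x
neg-excludes I ⊤c x () _
neg-excludes I ⊥c x _ ()
neg-excludes I (atom A) x ¬a a = ¬a a
neg-excludes I (natom A) x a ¬a = ¬a a
neg-excludes I (C ⊓ D) x (inj₁ n) (c , d) = neg-excludes I C x n c
neg-excludes I (C ⊓ D) x (inj₂ n) (c , d) = neg-excludes I D x n d
neg-excludes I (C ⊔ D) x (n , m) (inj₁ c) = neg-excludes I C x n c
neg-excludes I (C ⊔ D) x (n , m) (inj₂ d) = neg-excludes I D x m d
neg-excludes I (some R C) x n (y , r , c) = neg-excludes I C y (n y r) c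
neg-excludes I (all R C) x (y , r , n) c = neg-excludes I C y n (c y r)
neg-excludes I (atLeast zero S C) x () _
neg-excludes I (atLeast (suc n) S C) x fewer (ys , len , u , ps) =
  1+n≰n (subst (_≤ n) len (fewer ys u ps))
neg-excludes I (atMost n S C) x (ys , len , u , ps) fewer =
  1+n≰n (subst (_≤ n) len (fewer ys u ps))

module Closure (ℛ : RBox) (M : ModelGraph) (cs : ConsistentSaturated ℛ M) where
  open ModelGraph M
  open ConsistentSaturated cs

  I : Interpretation
  I = correspondingModel ℛ M

  ℰ′-inv : ∀ {R x y} → ℰ′ ℛ M R x y → ℰ′ ℛ M (R ⁻) y x
  ℰ′-inv (base e) = base (ℰ-inv _ _ _ e)
  ℰ′-inv (sub R⊑S e) = sub (inv R⊑S) (ℰ′-inv e)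
  ℰ′-inv (tr t e₁ e₂) = tr (inv t) (ℰ′-inv e₂) (ℰ′-inv e₁)

  roleI⇒ℰ′ : ∀ R {x y} → roleI I R x y → ℰ′ ℛ M R x y
  roleI⇒ℰ′ (rn r) e = e
  roleI⇒ℰ′ (inv r) e = ℰ′-inv e

  ℰ′⇒roleI : ∀ R {x y} → ℰ′ ℛ M R x y → roleI I R x y
  ℰ′⇒roleI (rn r) e = e
  ℰ′⇒roleI (inv r) e = ℰ′-inv e

  model-of-ℛ : ModelOfRBox I ℛ
  model-of-ℛ =
      (λ R S R⊑S x y e → ℰ′⇒roleI S (sub (ax R⊑S) (roleI⇒ℰ′ R e)))
    , (λ R t x y z e₁ e₂ →
         ℰ′⇒roleI R (tr (ax t) (roleI⇒ℰ′ R e₁) (roleI⇒ℰ′ R e₂)))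

  -- The second part is what makes the transitive case
  -- (an ℰ′-path through an intermediate node) go through.
  ∀-propagates : ∀ {S x y} → ℰ′ ℛ M S x y → ∀ T C → ℛ ⊢ S ⊑ T →
                 𝒞 x (all T C) → 𝒞 y C × (Trans ℛ T → 𝒞 y (all T C))
  ∀-propagates {S} {x} {y} (base e) T C S⊑T c =
      ∀-rule x y S C e (∀-sub x S T C c S⊑T)
    , λ t → ∀-trans x y T C (ℰ-sub S T x y e S⊑T) t c
  ∀-propagates (sub R⊑S e) T C S⊑T c = ∀-propagates e T C (trans R⊑S S⊑T) c
  ∀-propagates {S} {x} (tr t e₁ e₂) T C S⊑T c =
      proj₁ (∀-propagates e₂ S C refl
               (proj₂ (∀-propagates e₁ S C refl (∀-sub x S T C c S⊑T)) t))
    , λ tT → proj₂ (∀-propagates e₂ T C S⊑T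
                      (proj₂ (∀-propagates e₁ T C S⊑T c) tT)) tT

  -- An ℰ′-edge of a subrole of a simple role S is an ℰ-edge of S: a
  -- transitivity step would exhibit a transitive subrole of S.
  simple-edge : ∀ {R x y} → ℰ′ ℛ M R x y → ∀ S → ℛ ⊢ R ⊑ S → Simple ℛ S →
                ℰ S x y
  simple-edge {R} {x} {y} (base e) S R⊑S s = ℰ-sub R S x y e R⊑S
  simple-edge (sub Q⊑R e) S R⊑S s = simple-edge e S (trans Q⊑R R⊑S) s
  simple-edge {R} (tr t e₁ e₂) S R⊑S s = ⊥-elim (proj₂ s R R⊑S t)

-- The truth lemma.  The hypothesis that all labels are SHIQ concepts is
-- used only to know that number restrictions range over simple roles.
module Truth (ℛ : RBox) (M : ModelGraph) (cs : ConsistentSaturated ℛ M)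
             (wf : ∀ x C → ModelGraph.𝒞 M x C → WF ℛ C) where
  open ModelGraph M
  open ConsistentSaturated cs
  open Closure ℛ M cs

  Sound : Concept → Set
  Sound C = ∀ x → 𝒞 x C → ⟦ I ⟧ C x

  sound-⊤ : Sound ⊤c
  sound-⊤ x _ = tt

  sound-⊥ : Sound ⊥c
  sound-⊥ x c = no-⊥ x c

  sound-atom : ∀ A → Sound (atom A)
  sound-atom A x c = c

  sound-natom : ∀ A → Sound (natom A)
  sound-natom A x c a = no-clash x (natom A) c a

  sound-⊓ : ∀ {C D} → Sound C → Sound D → Sound (C ⊓ D)
  sound-⊓ {C} {D} sC sD x c with ⊓-rule x C D c
  ... | c₁ , c₂ = sC x c₁ , sD x c₂

  sound-⊔ : ∀ {C D} → Sound C → Sound D → Sound (C ⊔ D)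
  sound-⊔ {C} {D} sC sD x c with ⊔-rule x C D c
  ... | inj₁ c₁ = inj₁ (sC x c₁)
  ... | inj₂ c₂ = inj₂ (sD x c₂)

  sound-∃ : ∀ R {C} → Sound C → Sound (some R C)
  sound-∃ R {C} sC x c with ∃-rule x R C c
  ... | y , e , d = y , ℰ′⇒roleI R (base e) , sC y d

  sound-∀ : ∀ R {C} → Sound C → Sound (all R C)
  sound-∀ R {C} sC x c y e =
    sC y (proj₁ (∀-propagates (roleI⇒ℰ′ R e) R C refl c))

  sound-≥ : ∀ n S {C} → Sound C → Sound (atLeast n S C)
  sound-≥ n S {C} sC x c with ≥-rule x n S C c
  ... | ys , len , u , ps =
    ys , len , u , All.map (λ {y} (e , d) → ℰ′⇒roleI S (base e) , sC y d) ps

  -- Every I-successor of x along the simple role S satisfying C is an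
  -- ℰ-successor labelled C (it cannot be labelled C̄, by soundness of C̄),
  -- so the bound from saturation applies.
  sound-≤ : ∀ n S {C} → Sound C → Sound (neg C) → Sound (atMost n S C)
  sound-≤ n S {C} sC sC̄ x c ys u ps =
    ≤-rule x n S C c ys u (All.map counted ps)
    where
      simple : Simple ℛ S
      simple with wf x (atMost n S C) c
      ... | atMost _ s _ = s

      counted : ∀ {y} → roleI I S x y × ⟦ I ⟧ C y → ℰ S x y × 𝒞 y C
      counted {y} (r , d) with simple-edge (roleI⇒ℰ′ S r) S refl simple
      ... | e with ≤-choose x y n S C c e
      ... | inj₁ c₁ = e , c₁
      ... | inj₂ c̄ = ⊥-elim (neg-excludes I C y (sC̄ y c̄) d)

  truth : ∀ C → Sound C × Sound (neg C)
  truth ⊤c = sound-⊤ , sound-⊥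
  truth ⊥c = sound-⊥ , sound-⊤
  truth (atom A) = sound-atom A , sound-natom A
  truth (natom A) = sound-natom A , sound-atom A
  truth (C ⊓ D) with truth C | truth D
  ... | sC , sC̄ | sD , sD̄ = sound-⊓ sC sD , sound-⊔ sC̄ sD̄
  truth (C ⊔ D) with truth C | truth D
  ... | sC , sC̄ | sD , sD̄ = sound-⊔ sC sD , sound-⊓ sC̄ sD̄
  truth (some R C) with truth C
  ... | sC , sC̄ = sound-∃ R sC , sound-∀ R sC̄
  truth (all R C) with truth C
  ... | sC , sC̄ = sound-∀ R sC , sound-∃ R sC̄
  truth (atLeast zero S C) with truth C
  ... | sC , _ = sound-≥ zero S sC , sound-⊥
  truth (atLeast (suc n) S C) with truth C
  ... | sC , sC̄ = sound-≥ (suc n) S sC , sound-≤ n S sC sC̄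
  truth (atMost n S C) with truth C
  ... | sC , sC̄ = sound-≤ n S sC sC̄ , sound-≥ (suc n) S sC

lemma6 : (ℛ : RBox) (M : ModelGraph) →
    ConsistentSaturated ℛ M →
    (∀ x C → ModelGraph.𝒞 M x C → WF ℛ C) →
    ModelOfRBox (correspondingModel ℛ M) ℛ ×
    (∀ x C → ModelGraph.𝒞 M x C → ⟦ correspondingModel ℛ M ⟧ C x)
lemma6 ℛ M cs wf =
    Closure.model-of-ℛ ℛ M cs
  , λ x C c → proj₁ (Truth.truth ℛ M cs wf C) x c
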